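{- Let $H$ be a connected bipartite graph on $h$ vertices. Suppose that $\mathrm{ex}(n,H)=\Omega(n^{1+\alpha})$ for some $\alpha\in(0,1)$. Then there is a constant $c>0$ depending only on $H$ (and $\alpha$) such that for all integers $n\ge s\ge h$ we have $\mathrm{ex}^*(n,H,s)\ge c\, s^{1-\alpha}n^{1+\alpha}$.
   Context: $\mathrm{ex}(n,H)$ denotes the maximum number of edges in an $n$-vertex graph containing no subgraph isomorphic to $H$. For a positive integer $s$, $\mathrm{ex}^*(n,H,s)$ is the maximum number of edges in an $n$-vertex graph that contains no subgraph isomorphic to $K_{s,s}$ and no induced subgraph isomorphic to $H$. -}

module Defs where

open import Data.Nat using (ℕ; zero; suc; _+_; _*_; _∸_; _^_; _≤_; _<_; _<ᵇ_)
open import Data.Bool using (Bool; true; false; _∧_; _xor_; if_then_else_)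
open import Data.Bool.Properties using (xor-same)
open import Data.Fin using (Fin; toℕ)
open import Data.List using (List; map; allFin)
open import Data.Nat.ListAction using (sum)
open import Data.Product using (Σ; ∃; _×_; _,_)
open import Data.Integer using (∣_∣)
open import Data.Rational using (ℚ; ↥_; ↧ₙ_) renaming (_<_ to _<ℚ_; _≤_ to _≤ℚ_)
open import Data.Rational using (0ℚ; 1ℚ)
open import Function.Definitions using (Injective)
open import Relation.Binary.PropositionalEquality using (_≡_; _≢_; refl)
open import Relation.Nullary using (¬_)

record Graph (n : ℕ) : Set where
  field
    adj    : Fin n → Fin n → Bool
    sym    : ∀ i j → adj i j ≡ adj j i
    irrefl : ∀ i → adj i i ≡ false
open Graph public

edges : ∀ {n} → Graph n → ℕ
edges {n} G = sum (map (λ i → sum (map (λ j →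
  if (toℕ i <ᵇ toℕ j) ∧ adj G i j then 1 else 0) (allFin n))) (allFin n))

ContainsSub : ∀ {h n} → Graph h → Graph n → Set
ContainsSub {h} {n} H G = Σ (Fin h → Fin n) λ f →
  Injective _≡_ _≡_ f × (∀ u v → adj H u v ≡ true → adj G (f u) (f v) ≡ true)

ContainsInduced : ∀ {h n} → Graph h → Graph n → Set
ContainsInduced {h} {n} H G = Σ (Fin h → Fin n) λ f →
  Injective _≡_ _≡_ f × (∀ u v → adj G (f u) (f v) ≡ adj H u v)

private
  xor-comm : ∀ x y → x xor y ≡ y xor x
  xor-comm false false = refl
  xor-comm false true  = refl
  xor-comm true  false = refl
  xor-comm true  true  = refl

-- complete bipartite graph K_{s,s} on Fin (s + s): parts {i < s} and {i ≥ s}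
K : (s : ℕ) → Graph (s + s)
K s = record
  { adj    = λ i j → (toℕ i <ᵇ s) xor (toℕ j <ᵇ s)
  ; sym    = λ i j → xor-comm (toℕ i <ᵇ s) (toℕ j <ᵇ s)
  ; irrefl = λ i → xor-same (toℕ i <ᵇ s)
  }

data Walk {n} (G : Graph n) : Fin n → Fin n → Set where
  here : ∀ {u} → Walk G u u
  step : ∀ {u v w} → adj G u v ≡ true → Walk G v w → Walk G u w

Connected : ∀ {n} → Graph n → Set
Connected {n} G = ∀ (u v : Fin n) → Walk G u v

Bipartite : ∀ {n} → Graph n → Set
Bipartite {n} G = Σ (Fin n → Bool) λ col →
  ∀ u v → adj G u v ≡ true → col u ≢ col v

-- A real number α ∈ (0,1), given as a Dedekind lower cut L α ⊆ ℚ
-- (L α r  means  r < α).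

record Real01 : Set₁ where
  field
    L     : ℚ → Set
    down  : ∀ {p q} → q ≤ℚ p → L p → L q
    open' : ∀ {p} → L p → ∃ λ q → p <ℚ q × L q
    pos   : ∃ λ q → 0ℚ <ℚ q × L q
    lt1   : ∃ λ q → q <ℚ 1ℚ × ¬ L q
open Real01 public

-- For a positive rational r = p/q and positive constant a/b:
--   x ≥ (a/b) · n^(1+r)   ⟺   a^q · n^(q+p) ≤ (b·x)^q
GeqPow : (a b x n : ℕ) → ℚ → Set
GeqPow a b x n r = a ^ q * n ^ (q + p) ≤ (b * x) ^ q
  where p = ∣ ↥ r ∣ ; q = ↧ₙ r

--   x ≥ (a/b) · s^(1-r) · n^(1+r)   ⟺   a^q · s^(q-p) · n^(q+p) ≤ (b·x)^q
-- (used only for 0 < r < 1, so q ∸ p = q - p)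
GeqPow2 : (a b x s n : ℕ) → ℚ → Set
GeqPow2 a b x s n r = a ^ q * s ^ (q ∸ p) * n ^ (q + p) ≤ (b * x) ^ q
  where p = ∣ ↥ r ∣ ; q = ↧ₙ r

-- x ≥ (a/b) · n^(1+α) for real α: equivalent (by continuity in the exponent)
-- to the bound for every rational 0 < r < α.
GeqExp : (a b x n : ℕ) → Real01 → Set
GeqExp a b x n α = ∀ r → 0ℚ <ℚ r → L α r → GeqPow a b x n r

-- x ≥ (a/b) · s^(1-α) · n^(1+α) for real α (same continuity argument).
GeqExp2 : (a b x s n : ℕ) → Real01 → Set
GeqExp2 a b x s n α = ∀ r → 0ℚ <ℚ r → L α r → GeqPow2 a b x s n r

-- "ex(n,H) ≥ (a/b) n^(1+α)": some H-free n-vertex graph has that many edges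
ExAtLeast : ∀ {h} → Graph h → (a b n : ℕ) → Real01 → Set
ExAtLeast H a b n α =
  Σ (Graph n) λ G → ¬ ContainsSub H G × GeqExp a b (edges G) n α

-- "ex(n,H) = Ω(n^(1+α))"
ExOmega : ∀ {h} → Graph h → Real01 → Set
ExOmega H α = Σ ℕ λ a → Σ ℕ λ b → 0 < a × 0 < b ×
  Σ ℕ λ N → ∀ n → N ≤ n → ExAtLeast H a b n α

-- "ex*(n,H,s) ≥ (a/b) s^(1-α) n^(1+α)"
ExStarAtLeast : ∀ {h} → Graph h → (a b n s : ℕ) → Real01 → Set
ExStarAtLeast H a b n s α =
  Σ (Graph n) λ G → ¬ ContainsSub (K s) G × ¬ ContainsInduced H G
    × GeqExp2 a b (edges G) s n α

module Submission where

-- If h ≤ 2, a single edge already contains H, so H-free graphs are edgeless and ex(n,H) = 0.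
-- If h ≥ 3, take t = 2⌊s/2h⌋ and an H-free graph F on m = ⌊n/t⌋ vertices with e(F) ≳ m^(1+α), and
-- blow every vertex of F up into a clique on t vertices. An induced copy of H never puts two vertices
-- into one clique, because H is connected, triangle-free and has a third vertex; and a K_{s,s} has
-- s ≥ h t vertices on each side, so it meets h distinct cliques on the sides prescribed by a
-- 2-colouring of H. Either way H would embed into F. The blow-up has t² e(F) ≳ t^(1-α) n^(1+α)
-- ≈ s^(1-α) n^(1+α) edges. When m is below the threshold of the extremal bound the cliques alone
-- give about n t edges, which suffices since n/t is bounded; s < 2h (take t = 1) and bounded n
-- (one edge) only cost constants. Rational exponents r < α turn each bound into one between q-th
-- powers of naturals.

open import Defs hiding (sym)
open import Data.Bool using (Bool; true; false; not; _∧_; _∨_; _xor_; if_then_else_)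
open import Data.Bool.Properties using (T-≡; ¬-not; not-involutive; ∧-zeroʳ; ∨-zeroʳ)
open import Data.Empty using (⊥; ⊥-elim)
open import Data.Fin using (Fin; zero; suc; toℕ; fromℕ<; inject≤; combine; _↑ˡ_; _↑ʳ_)
open import Data.Fin.Properties
  using (toℕ<n; toℕ-injective; toℕ-fromℕ<; fromℕ<-toℕ; toℕ-↑ˡ; toℕ-↑ʳ; ↑ˡ-injective; ↑ʳ-injective;
         combine-injective; inject≤-injective; injective⇒≤; any?; all?)
  renaming (_≟_ to _≟ᶠ_)
open import Data.Integer using (∣_∣)
import Data.Integer as ℤ
import Data.Integer.Properties as ℤ
open import Data.List using (map; allFin; tabulate)
open import Data.List.Properties using (map-cong; map-tabulate)
open import Data.Nat
  using (ℕ; zero; suc; _+_; _*_; _∸_; _^_; _/_; _%_; _≤_; _<_; _≡ᵇ_; _<ᵇ_; _≤?_; _<?_; z≤n; s≤s;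
         NonZero; >-nonZero; >-nonZero⁻¹)
open import Data.Nat.Properties
open import Data.Nat.DivMod
  using (m≡m%n+[m/n]*n; m%n<n; /-congˡ; +-distrib-/-∣ʳ; m<n⇒m/n≡0; m*n/n≡m; m/n*n≤m; m/n≡0⇒m<n; m≥n⇒m/n>0)
open import Data.Nat.Divisibility using (divides)
open import Data.Nat.ListAction using (sum)
open import Data.Nat.Tactic.RingSolver using (solve-∀)
open import Data.Product using (Σ; ∃; ∃₂; _×_; _,_; proj₁; proj₂)
open import Data.Rational using (mkℚ; ↥_; ↧ₙ_; 0ℚ; 1ℚ) renaming (_<_ to _<ℚ_)
import Data.Rational.Properties as ℚ
open import Data.Sum using (_⊎_; inj₁; inj₂; [_,_]′)
open import Function using (_∘_)
open import Function.Bundles using (Equivalence)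
open import Function.Definitions using (Injective)
open import Level using (Level)
open import Relation.Binary.PropositionalEquality
open import Relation.Nullary using (¬_; yes; no)
open import Relation.Nullary.Decidable using (¬?; _⊎-dec_)
open import Relation.Unary using (Pred; Decidable)

private variable
  ℓ : Level
  h n : ℕ

∑< : ℕ → (ℕ → ℕ) → ℕ
∑< zero    f = 0
∑< (suc n) f = f 0 + ∑< n (f ∘ suc)

infix 5 ∑<
syntax ∑< n (λ i → e) = ∑[ i < n ] e

sum-allFin≡∑ : ∀ n (f : ℕ → ℕ) → sum (map (f ∘ toℕ) (allFin n)) ≡ ∑< n f
sum-allFin≡∑ n f = trans (cong sum (map-tabulate {n = n} (λ i → i) (f ∘ toℕ))) (go n f)
  where
  go : ∀ n (f : ℕ → ℕ) → sum (tabulate {n = n} (f ∘ toℕ)) ≡ ∑< n f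
  go zero    f = refl
  go (suc n) f = cong (f 0 +_) (go n (f ∘ suc))

∑-cong : ∀ n {f g : ℕ → ℕ} → (∀ i → i < n → f i ≡ g i) → ∑< n f ≡ ∑< n g
∑-cong zero    f≡g = refl
∑-cong (suc n) f≡g = cong₂ _+_ (f≡g 0 (s≤s z≤n)) (∑-cong n (λ i i<n → f≡g (suc i) (s≤s i<n)))

∑-mono-≤ : ∀ n {f g : ℕ → ℕ} → (∀ i → i < n → f i ≤ g i) → ∑< n f ≤ ∑< n g
∑-mono-≤ zero    f≤g = z≤n
∑-mono-≤ (suc n) f≤g = +-mono-≤ (f≤g 0 (s≤s z≤n)) (∑-mono-≤ n (λ i i<n → f≤g (suc i) (s≤s i<n)))

∑-+ : ∀ m n (f : ℕ → ℕ) → ∑< (m + n) f ≡ ∑< m f + (∑[ i < n ] f (m + i))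
∑-+ zero    n f = refl
∑-+ (suc m) n f = trans (cong (f 0 +_) (∑-+ m n (f ∘ suc))) (sym (+-assoc (f 0) _ _))

∑-prefix-≤ : ∀ {m n} (f : ℕ → ℕ) → m ≤ n → ∑< m f ≤ ∑< n f
∑-prefix-≤ {m} f m≤n with m≤n⇒∃[o]m+o≡n m≤n
... | o , refl = subst (∑< m f ≤_) (sym (∑-+ m o f)) (m≤m+n _ _)

∑-term-≤ : ∀ n (f : ℕ → ℕ) {i} → i < n → f i ≤ ∑< n f
∑-term-≤ (suc n) f {zero}  _         = m≤m+n _ _
∑-term-≤ (suc n) f {suc i} (s≤s i<n) = ≤-trans (∑-term-≤ n (f ∘ suc) i<n) (m≤n+m _ _)

∑-const : ∀ n c → ∑[ _ < n ] c ≡ n * c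
∑-const zero    c = refl
∑-const (suc n) c = cong (c +_) (∑-const n c)

∑-*-distribˡ : ∀ n c (f : ℕ → ℕ) → ∑[ i < n ] c * f i ≡ c * ∑< n f
∑-*-distribˡ zero    c f = sym (*-zeroʳ c)
∑-*-distribˡ (suc n) c f =
  trans (cong (c * f 0 +_) (∑-*-distribˡ n c (f ∘ suc))) (sym (*-distribˡ-+ c (f 0) _))

∑-blocks : ∀ m t (f : ℕ → ℕ) → ∑< (m * t) f ≡ ∑[ u < m ] ∑[ a < t ] f (u * t + a)
∑-blocks zero    t f = refl
∑-blocks (suc m) t f = trans (∑-+ t (m * t) f) (cong (∑< t f +_) (trans (∑-blocks m t (λ i → f (t + i)))
  (∑-cong m (λ u _ → ∑-cong t (λ a _ → cong f (sym (+-assoc t (u * t) a)))))))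

∑-repeat : ∀ m t (f : ℕ → ℕ → ℕ) →
  ∑[ u < m ] ∑[ a < t ] ∑[ v < m ] ∑[ b < t ] f u v ≡ t * t * (∑[ u < m ] ∑[ v < m ] f u v)
∑-repeat m t f = begin
  ∑[ u < m ] ∑[ a < t ] ∑[ v < m ] ∑[ b < t ] f u v
    ≡⟨ ∑-cong m (λ u _ → ∑-cong t (λ _ _ → ∑-cong m (λ v _ → ∑-const t (f u v)))) ⟩
  ∑[ u < m ] ∑[ a < t ] ∑[ v < m ] t * f u v
    ≡⟨ ∑-cong m (λ u _ → ∑-cong t (λ _ _ → ∑-*-distribˡ m t (f u))) ⟩
  ∑[ u < m ] ∑[ a < t ] t * (∑[ v < m ] f u v)
    ≡⟨ ∑-cong m (λ u _ → ∑-const t _) ⟩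
  ∑[ u < m ] t * (t * (∑[ v < m ] f u v))
    ≡⟨ ∑-*-distribˡ m t _ ⟩
  t * (∑[ u < m ] t * (∑[ v < m ] f u v))
    ≡⟨ cong (t *_) (∑-*-distribˡ m t _) ⟩
  t * (t * (∑[ u < m ] ∑[ v < m ] f u v))
    ≡⟨ *-assoc t t _ ⟨
  t * t * (∑[ u < m ] ∑[ v < m ] f u v)
    ∎
  where open ≡-Reasoning

𝟙 : Bool → ℕ
𝟙 b = if b then 1 else 0

𝟙-mono : ∀ {b c} → (b ≡ true → c ≡ true) → 𝟙 b ≤ 𝟙 c
𝟙-mono {false} _   = z≤n
𝟙-mono {true}  b⇒c rewrite b⇒c refl = s≤s z≤n

≡ᵇ-refl : ∀ n → (n ≡ᵇ n) ≡ true
≡ᵇ-refl zero    = refl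
≡ᵇ-refl (suc n) = ≡ᵇ-refl n

≡ᵇ-sym : ∀ m n → (m ≡ᵇ n) ≡ (n ≡ᵇ m)
≡ᵇ-sym zero    zero    = refl
≡ᵇ-sym zero    (suc n) = refl
≡ᵇ-sym (suc m) zero    = refl
≡ᵇ-sym (suc m) (suc n) = ≡ᵇ-sym m n

≢⇒≡ᵇ≡false : ∀ {m n} → m ≢ n → (m ≡ᵇ n) ≡ false
≢⇒≡ᵇ≡false {zero}  {zero}  m≢n = ⊥-elim (m≢n refl)
≢⇒≡ᵇ≡false {zero}  {suc n} _   = refl
≢⇒≡ᵇ≡false {suc m} {zero}  _   = refl
≢⇒≡ᵇ≡false {suc m} {suc n} m≢n = ≢⇒≡ᵇ≡false (m≢n ∘ cong suc)

<⇒<ᵇ≡true : ∀ {m n} → m < n → (m <ᵇ n) ≡ true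
<⇒<ᵇ≡true = Equivalence.to T-≡ ∘ <⇒<ᵇ

<ᵇ≡true⇒< : ∀ {m n} → (m <ᵇ n) ≡ true → m < n
<ᵇ≡true⇒< {m} {n} = <ᵇ⇒< m n ∘ Equivalence.from T-≡

∧≡true : ∀ {x y} → x ∧ y ≡ true → x ≡ true × y ≡ true
∧≡true {true} {true} _ = refl , refl

k*k≤pairs : ∀ k → k * k ≤ ∑[ a < k + k ] ∑[ b < k + k ] 𝟙 (a <ᵇ b)
k*k≤pairs k = begin
  k * k
    ≡⟨ ∑-const k k ⟨
  ∑[ a < k ] k
    ≤⟨ ∑-mono-≤ k (λ a a<k → ≤-trans (later a<k) (m≤n+m _ _)) ⟩
  ∑[ a < k ] ((∑[ b < k ] 𝟙 (a <ᵇ b)) + (∑[ b < k ] 𝟙 (a <ᵇ k + b)))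
    ≡⟨ ∑-cong k (λ a _ → ∑-+ k k (λ b → 𝟙 (a <ᵇ b))) ⟨
  ∑[ a < k ] ∑[ b < k + k ] 𝟙 (a <ᵇ b)
    ≤⟨ ∑-prefix-≤ _ (m≤m+n k k) ⟩
  ∑[ a < k + k ] ∑[ b < k + k ] 𝟙 (a <ᵇ b)
    ∎
  where
  open ≤-Reasoning
  later : ∀ {a} → a < k → k ≤ ∑[ b < k ] 𝟙 (a <ᵇ k + b)
  later {a} a<k = ≤-reflexive (begin-equality
    k                         ≡⟨ *-identityʳ k ⟨
    k * 1                     ≡⟨ ∑-const k 1 ⟨
    ∑[ b < k ] 1              ≡⟨ ∑-cong k (λ b _ → cong 𝟙 (<⇒<ᵇ≡true (≤-trans a<k (m≤m+n k b)))) ⟨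
    ∑[ b < k ] 𝟙 (a <ᵇ k + b) ∎)

edges≡∑ : (G : Graph n) (A : ℕ → ℕ → Bool) → (∀ i j → adj G i j ≡ A (toℕ i) (toℕ j)) →
  edges G ≡ ∑[ i < n ] ∑[ j < n ] 𝟙 ((i <ᵇ j) ∧ A i j)
edges≡∑ {n} G A G≡A = trans
  (cong sum (map-cong (λ i → trans
     (cong sum (map-cong (λ j → cong (λ b → 𝟙 ((toℕ i <ᵇ toℕ j) ∧ b)) (G≡A i j)) (allFin n)))
     (sum-allFin≡∑ n (λ j → 𝟙 ((toℕ i <ᵇ j) ∧ A (toℕ i) j)))) (allFin n)))
  (sum-allFin≡∑ n (λ i → ∑[ j < n ] 𝟙 ((i <ᵇ j) ∧ A i j)))

edgeless⇒edges≡0 : (G : Graph n) → (∀ i j → adj G i j ≡ false) → edges G ≡ 0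
edgeless⇒edges≡0 {n} G no-edge = begin
  edges G
    ≡⟨ edges≡∑ G (λ _ _ → false) no-edge ⟩
  ∑[ i < n ] ∑[ j < n ] 𝟙 ((i <ᵇ j) ∧ false)
    ≡⟨ ∑-cong n (λ i _ → ∑-cong n (λ j _ → cong 𝟙 (∧-zeroʳ (i <ᵇ j)))) ⟩
  ∑[ i < n ] ∑[ j < n ] 0
    ≡⟨ ∑-cong n (λ _ _ → trans (∑-const n 0) (*-zeroʳ n)) ⟩
  ∑[ i < n ] 0
    ≡⟨ trans (∑-const n 0) (*-zeroʳ n) ⟩
  0
    ∎
  where open ≡-Reasoning

adj⇒≢ : (G : Graph n) {i j : Fin n} → adj G i j ≡ true → i ≢ j
adj⇒≢ G {i} ij refl with trans (sym ij) (irrefl G i)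
... | ()

adjℕ : ∀ {m} → Graph m → ℕ → ℕ → Bool
adjℕ {m} F x y with x <? m | y <? m
... | yes x<m | yes y<m = adj F (fromℕ< x<m) (fromℕ< y<m)
... | _       | _       = false

adjℕ-toℕ : ∀ {m} (F : Graph m) (u v : Fin m) → adjℕ F (toℕ u) (toℕ v) ≡ adj F u v
adjℕ-toℕ {m} F u v with toℕ u <? m | toℕ v <? m
... | yes u<m | yes v<m = cong₂ (adj F) (fromℕ<-toℕ u u<m) (fromℕ<-toℕ v v<m)
... | no u≮m  | _       = ⊥-elim (u≮m (toℕ<n u))
... | yes _   | no v≮m  = ⊥-elim (v≮m (toℕ<n v))

adjℕ-sym : ∀ {m} (F : Graph m) → ∀ x y → adjℕ F x y ≡ adjℕ F y x
adjℕ-sym {m} F x y with x <? m | y <? m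
... | yes _ | yes _ = Graph.sym F _ _
... | yes _ | no _  = refl
... | no _  | yes _ = refl
... | no _  | no _  = refl

adjℕ⇒< : ∀ {m} (F : Graph m) → ∀ {x y} → adjℕ F x y ≡ true → x < m
adjℕ⇒< {m} F {x} {y} xy with x <? m | y <? m
... | yes x<m | yes _ = x<m
adjℕ⇒< F () | yes _ | no _
adjℕ⇒< F () | no _  | _

NoIsolated : Graph h → Set
NoIsolated {h} H = ∀ (u : Fin h) → ∃ λ v → adj H u v ≡ true

ContainsSub-fromℕ : ∀ {m} (H : Graph h) (F : Graph m) → NoIsolated H → (φ : Fin h → ℕ) → Injective _≡_ _≡_ φ →
  (∀ u v → adj H u v ≡ true → adjℕ F (φ u) (φ v) ≡ true) → ContainsSub H F
ContainsSub-fromℕ {h} {m} H F no-isolated φ φ-inj φ-adj = ψ , ψ-inj , ψ-adj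
  where
  φ<m : ∀ u → φ u < m
  φ<m u = let v , uv = no-isolated u in adjℕ⇒< F (φ-adj u v uv)
  ψ : Fin h → Fin m
  ψ u = fromℕ< (φ<m u)
  toℕ-ψ : ∀ u → toℕ (ψ u) ≡ φ u
  toℕ-ψ u = toℕ-fromℕ< (φ<m u)
  ψ-inj : Injective _≡_ _≡_ ψ
  ψ-inj {u} {v} ψu≡ψv = φ-inj (trans (sym (toℕ-ψ u)) (trans (cong toℕ ψu≡ψv) (toℕ-ψ v)))
  ψ-adj : ∀ u v → adj H u v ≡ true → adj F (ψ u) (ψ v) ≡ true
  ψ-adj u v uv = trans (sym (adjℕ-toℕ F (ψ u) (ψ v)))
    (trans (cong₂ (adjℕ F) (toℕ-ψ u) (toℕ-ψ v)) (φ-adj u v uv))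

ContainsSub⇒≤ : (H : Graph h) (G : Graph n) → ContainsSub H G → h ≤ n
ContainsSub⇒≤ _ _ (_ , f-inj , _) = injective⇒≤ f-inj

bipartite⇒triangle-free : (H : Graph h) → Bipartite H → ∀ {x y z} →
  adj H x y ≡ true → adj H y z ≡ true → adj H x z ≡ true → ⊥
bipartite⇒triangle-free H (col , proper) {x} {y} {z} xy yz xz = proper x z xz (begin
  col x             ≡⟨ ¬-not (proper x y xy) ⟩
  not (col y)       ≡⟨ cong not (¬-not (proper y z yz)) ⟩
  not (not (col z)) ≡⟨ not-involutive (col z) ⟩
  col z             ∎)
  where open ≡-Reasoning

walk-exit : {G : Graph n} {P : Pred (Fin n) ℓ} → Decidable P → ∀ {x w} → P x → ¬ P w → Walk G x w →
  ∃₂ λ x′ y → P x′ × ¬ P y × adj G x′ y ≡ true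
walk-exit P? Px ¬Pw here = ⊥-elim (¬Pw Px)
walk-exit P? {x} Px ¬Pw (step {v = y} xy walk) with P? y
... | yes Py  = walk-exit P? Py ¬Pw walk
... | no  ¬Py = x , y , Px , ¬Py , xy

connected⇒NoIsolated : (H : Graph h) → 2 ≤ h → Connected H → NoIsolated H
connected⇒NoIsolated H (s≤s (s≤s _)) conn u = first-edge (other≢ u) (conn u (other u))
  where
  other : ∀ {k} → Fin (suc (suc k)) → Fin (suc (suc k))
  other zero    = suc zero
  other (suc _) = zero
  other≢ : ∀ {k} (u : Fin (suc (suc k))) → u ≢ other u
  other≢ zero    ()
  other≢ (suc _) ()
  first-edge : ∀ {u w} → u ≢ w → Walk H u w → ∃ λ v → adj H u v ≡ true
  first-edge u≢w here             = ⊥-elim (u≢w refl)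
  first-edge _   (step {v = v} uv _) = v , uv

another-vertex : 3 ≤ h → (u v : Fin h) → ∃ λ w → w ≢ u × w ≢ v
another-vertex (s≤s (s≤s (s≤s _))) = go
  where
  go : ∀ {k} (u v : Fin (suc (suc (suc k)))) → ∃ λ w → w ≢ u × w ≢ v
  go zero          zero          = suc zero , (λ ()) , (λ ())
  go zero          (suc zero)    = suc (suc zero) , (λ ()) , (λ ())
  go zero          (suc (suc _)) = suc zero , (λ ()) , (λ ())
  go (suc zero)    zero          = suc (suc zero) , (λ ()) , (λ ())
  go (suc (suc _)) zero          = suc zero , (λ ()) , (λ ())
  go (suc _)       (suc _)       = zero , (λ ()) , (λ ())

edge⇒ContainsSub-order≤2 : (H : Graph h) (G : Graph n) → h ≤ 2 → ∀ {i j} → adj G i j ≡ true → ContainsSub H G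
edge⇒ContainsSub-order≤2 H G h≤2 {i} {j} ij = e∘ι , e∘ι-inj , e∘ι-adj
  where
  ι : Fin _ → Fin 2
  ι u = inject≤ u h≤2
  e : Fin 2 → Fin _
  e zero    = i
  e (suc _) = j
  e-adj : ∀ x y → x ≢ y → adj G (e x) (e y) ≡ true
  e-adj zero       zero       x≢y = ⊥-elim (x≢y refl)
  e-adj zero       (suc zero) _   = ij
  e-adj (suc zero) zero       _   = trans (Graph.sym G j i) ij
  e-adj (suc zero) (suc zero) x≢y = ⊥-elim (x≢y refl)
  e-inj : Injective _≡_ _≡_ e
  e-inj {x} {y} ex≡ey with x | y
  ... | zero     | zero     = refl
  ... | suc zero | suc zero = refl
  ... | zero     | suc zero = ⊥-elim (adj⇒≢ G ij ex≡ey)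
  ... | suc zero | zero     = ⊥-elim (adj⇒≢ G ij (sym ex≡ey))
  e∘ι : Fin _ → Fin _
  e∘ι u = e (ι u)
  e∘ι-inj : Injective _≡_ _≡_ e∘ι
  e∘ι-inj eq = inject≤-injective h≤2 h≤2 _ _ (e-inj eq)
  e∘ι-adj : ∀ u v → adj H u v ≡ true → adj G (e∘ι u) (e∘ι v) ≡ true
  e∘ι-adj u v uv = e-adj (ι u) (ι v) (λ ιu≡ιv → adj⇒≢ H uv (inject≤-injective h≤2 h≤2 u v ιu≡ιv))

edgeless : ∀ m → Graph m
edgeless m = record { adj = λ _ _ → false ; sym = λ _ _ → refl ; irrefl = λ _ → refl }

edgeless-free : ∀ {m} (H : Graph h) → ∀ {u v} → adj H u v ≡ true → ¬ ContainsSub H (edgeless m)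
edgeless-free H uv (_ , _ , f-adj) with f-adj _ _ uv
... | ()

K-vertex : ∀ s → Bool → Fin s → Fin (s + s)
K-vertex s true  y = y ↑ˡ s
K-vertex s false y = s ↑ʳ y

K-vertex-injective : ∀ s c → Injective _≡_ _≡_ (K-vertex s c)
K-vertex-injective s true  = ↑ˡ-injective s _ _
K-vertex-injective s false = ↑ʳ-injective s _ _

K-vertex-side : ∀ s c (y : Fin s) → (toℕ (K-vertex s c y) <ᵇ s) ≡ c
K-vertex-side s true  y = <⇒<ᵇ≡true (subst (_< s) (sym (toℕ-↑ˡ y s)) (toℕ<n y))
K-vertex-side s false y = trans (cong (_<ᵇ s) (toℕ-↑ʳ s y)) (+<ᵇ≡false s (toℕ y))
  where
  +<ᵇ≡false : ∀ s x → (s + x <ᵇ s) ≡ false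
  +<ᵇ≡false zero    x = refl
  +<ᵇ≡false (suc s) x = +<ᵇ≡false s x

K-adj-sides : ∀ s {c c′} → c ≢ c′ → ∀ y y′ → adj (K s) (K-vertex s c y) (K-vertex s c′ y′) ≡ true
K-adj-sides s {c} {c′} c≢c′ y y′ =
  trans (cong₂ _xor_ (K-vertex-side s c y) (K-vertex-side s c′ y′)) (xor-≢ c≢c′)
  where
  xor-≢ : ∀ {c c′} → c ≢ c′ → c xor c′ ≡ true
  xor-≢ {true}  {true}  c≢c′ = ⊥-elim (c≢c′ refl)
  xor-≢ {true}  {false} _    = refl
  xor-≢ {false} {true}  _    = refl
  xor-≢ {false} {false} c≢c′ = ⊥-elim (c≢c′ refl)

-- Otherwise y ↦ (block index, e y mod t) would inject Fin s into Fin (j * t).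
avoid-blocks : ∀ {s j} t .{{_ : NonZero t}} (e : Fin s → ℕ) → Injective _≡_ _≡_ e →
  (φ : Fin j → ℕ) → j * t < s → ∃ λ y → ∀ i → e y / t ≢ φ i
avoid-blocks {s} {j} t e e-inj φ jt<s with any? (λ y → all? (λ i → ¬? (e y / t ≟ φ i)))
... | yes found = found
... | no  none  = ⊥-elim (<⇒≱ jt<s (injective⇒≤ code-inj))
  where
  block-of : ∀ y → ∃ λ i → e y / t ≡ φ i
  block-of y with any? (λ i → e y / t ≟ φ i)
  ... | yes hit  = hit
  ... | no  miss = ⊥-elim (none (y , λ i eq → miss (i , eq)))
  code : Fin s → Fin (j * t)
  code y = combine (proj₁ (block-of y)) (fromℕ< (m%n<n (e y) t))
  code-inj : Injective _≡_ _≡_ code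
  code-inj {y} {y′} code≡ = e-inj (begin
    e y                        ≡⟨ m≡m%n+[m/n]*n (e y) t ⟩
    e y % t + e y / t * t      ≡⟨ cong₂ (λ r q → r + q * t) same-rem same-quot ⟩
    e y′ % t + e y′ / t * t    ≡⟨ sym (m≡m%n+[m/n]*n (e y′) t) ⟩
    e y′                       ∎)
    where
    open ≡-Reasoning
    parts : proj₁ (block-of y) ≡ proj₁ (block-of y′) × fromℕ< (m%n<n (e y) t) ≡ fromℕ< (m%n<n (e y′) t)
    parts = combine-injective _ _ _ _ code≡
    same-quot : e y / t ≡ e y′ / t
    same-quot = trans (proj₂ (block-of y)) (trans (cong φ (proj₁ parts)) (sym (proj₂ (block-of y′))))
    same-rem : e y % t ≡ e y′ % t
    same-rem = trans (sym (toℕ-fromℕ< (m%n<n (e y) t)))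
      (trans (cong toℕ (proj₂ parts)) (toℕ-fromℕ< (m%n<n (e y′) t)))

separate-blocks : ∀ {s} j t .{{_ : NonZero t}} (e : Fin j → Fin s → ℕ) → (∀ i → Injective _≡_ _≡_ (e i)) →
  j * t ≤ s → ∃ λ (y : Fin j → Fin s) → Injective _≡_ _≡_ (λ i → e i (y i) / t)
separate-blocks zero    t e e-inj _    = (λ ()) , λ { {()} }
separate-blocks (suc j) t e e-inj jt≤s = y , y-inj
  where
  rest : ∃ λ (y : Fin j → Fin _) → Injective _≡_ _≡_ (λ i → e (suc i) (y i) / t)
  rest = separate-blocks j t (e ∘ suc) (e-inj ∘ suc) (m+n≤o⇒n≤o t jt≤s)
  fresh : ∃ λ y → ∀ i → e zero y / t ≢ e (suc i) (proj₁ rest i) / t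
  fresh = avoid-blocks t (e zero) (e-inj zero) (λ i → e (suc i) (proj₁ rest i) / t)
    (≤-trans (+-monoˡ-≤ (j * t) (>-nonZero⁻¹ t)) jt≤s)
  y : Fin (suc j) → Fin _
  y zero    = proj₁ fresh
  y (suc i) = proj₁ rest i
  y-inj : Injective _≡_ _≡_ (λ i → e i (y i) / t)
  y-inj {zero}  {zero}   _  = refl
  y-inj {zero}  {suc i′} eq = ⊥-elim (proj₂ fresh i′ eq)
  y-inj {suc i} {zero}   eq = ⊥-elim (proj₂ fresh i (sym eq))
  y-inj {suc i} {suc i′} eq = cong suc (proj₂ rest eq)

-- Vertex i lies in block i / t and every block is a clique. Blocks below m are the vertices of F;
-- the leftover blocks from m on are attached to nothing.
module BlowUp {m} (F : Graph m) (t : ℕ) .{{_ : NonZero t}} (n : ℕ) where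

  block : ℕ → ℕ
  block i = i / t

  near : ℕ → ℕ → Bool
  near x y = (x ≡ᵇ y) ∨ adjℕ F x y

  linked : ℕ → ℕ → Bool
  linked i j = not (i ≡ᵇ j) ∧ near (block i) (block j)

  graph : Graph n
  graph = record
    { adj    = λ i j → linked (toℕ i) (toℕ j)
    ; sym    = λ i j → cong₂ (λ b c → not b ∧ c) (≡ᵇ-sym (toℕ i) (toℕ j))
                 (cong₂ _∨_ (≡ᵇ-sym (block (toℕ i)) (block (toℕ j))) (adjℕ-sym F _ _))
    ; irrefl = λ i → cong (λ b → not b ∧ near (block (toℕ i)) (block (toℕ i))) (≡ᵇ-refl (toℕ i))
    }

  linked≡near : ∀ {i j} → i ≢ j → linked i j ≡ near (block i) (block j)
  linked≡near i≢j rewrite ≢⇒≡ᵇ≡false i≢j = refl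

  near-refl : ∀ x → near x x ≡ true
  near-refl x rewrite ≡ᵇ-refl x = refl

  near⇒adjℕ : ∀ {x y} → x ≢ y → near x y ≡ true → adjℕ F x y ≡ true
  near⇒adjℕ x≢y xy rewrite ≢⇒≡ᵇ≡false x≢y = xy

  same-block⇒adj : ∀ {i j} → i ≢ j → block (toℕ i) ≡ block (toℕ j) → adj graph i j ≡ true
  same-block⇒adj {i} {j} i≢j same = begin
    linked (toℕ i) (toℕ j)               ≡⟨ linked≡near (i≢j ∘ toℕ-injective) ⟩
    near (block (toℕ i)) (block (toℕ j)) ≡⟨ cong (near _) (sym same) ⟩
    near (block (toℕ i)) (block (toℕ i)) ≡⟨ near-refl _ ⟩
    true                                 ∎
    where open ≡-Reasoning

  twin-adj : ∀ {i i′ k} → block (toℕ i) ≡ block (toℕ i′) → i′ ≢ k →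
    adj graph i k ≡ true → adj graph i′ k ≡ true
  twin-adj {i} {i′} {k} same i′≢k ik = begin
    linked (toℕ i′) (toℕ k)               ≡⟨ linked≡near (i′≢k ∘ toℕ-injective) ⟩
    near (block (toℕ i′)) (block (toℕ k)) ≡⟨ cong (λ x → near x _) same ⟨
    near (block (toℕ i)) (block (toℕ k))  ≡⟨ linked≡near (adj⇒≢ graph ik ∘ toℕ-injective) ⟨
    linked (toℕ i) (toℕ k)                ≡⟨ ik ⟩
    true                                  ∎
    where open ≡-Reasoning

  ContainsSub-fromBlocks : (H : Graph h) → NoIsolated H → (g : Fin h → Fin n) →
    Injective _≡_ _≡_ (λ u → block (toℕ (g u))) →
    (∀ u v → adj H u v ≡ true → adj graph (g u) (g v) ≡ true) → ContainsSub H F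
  ContainsSub-fromBlocks H no-isolated g blocks-inj g-adj =
    ContainsSub-fromℕ H F no-isolated (λ u → block (toℕ (g u))) blocks-inj φ-adj
    where
    φ-adj : ∀ u v → adj H u v ≡ true → adjℕ F (block (toℕ (g u))) (block (toℕ (g v))) ≡ true
    φ-adj u v uv = near⇒adjℕ blocks≢ (trans (sym (linked≡near (blocks≢ ∘ cong block))) (g-adj u v uv))
      where
      blocks≢ : block (toℕ (g u)) ≢ block (toℕ (g v))
      blocks≢ = adj⇒≢ H uv ∘ blocks-inj

  -- Two H-vertices in one block are adjacent, and any neighbour of one of them outside the pair is a
  -- neighbour of both; leaving the pair along a walk to a third vertex thus closes a triangle.
  induced-free : (H : Graph h) → Connected H → Bipartite H → 3 ≤ h → ¬ ContainsSub H F →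
    ¬ ContainsInduced H graph
  induced-free H conn bip 3≤h F-free (f , f-inj , f-induced) =
    F-free (ContainsSub-fromBlocks H no-isolated f blocks-inj (λ u v → trans (f-induced u v)))
    where
    no-isolated : NoIsolated H
    no-isolated = connected⇒NoIsolated H (≤-trans (n≤1+n 2) 3≤h) conn
    φ : Fin _ → ℕ
    φ u = block (toℕ (f u))
    in-H : ∀ {u v} → adj graph (f u) (f v) ≡ true → adj H u v ≡ true
    in-H {u} {v} = trans (sym (f-induced u v))
    blocks-inj : Injective _≡_ _≡_ φ
    blocks-inj {u} {v} φu≡φv with u ≟ᶠ v
    ... | yes u≡v = u≡v
    ... | no  u≢v with another-vertex 3≤h u v
    ...   | w , w≢u , w≢v with walk-exit (λ z → (z ≟ᶠ u) ⊎-dec (z ≟ᶠ v)) (inj₁ refl) [ w≢u , w≢v ]′ (conn u w)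
    ...     | x , y , x∈ , y∉ , xy = ⊥-elim (bipartite⇒triangle-free H bip uv vy uy)
      where
      fx-fy : adj graph (f x) (f y) ≡ true
      fx-fy = trans (f-induced x y) xy
      uv : adj H u v ≡ true
      uv = in-H (same-block⇒adj (u≢v ∘ f-inj) φu≡φv)
      fy∉ : ∀ {z} → z ≡ u ⊎ z ≡ v → f z ≢ f y
      fy∉ z∈ fz≡fy = y∉ (subst (λ z → z ≡ u ⊎ z ≡ v) (f-inj fz≡fy) z∈)
      φx≡φu : φ x ≡ φ u
      φx≡φu = [ cong φ , (λ x≡v → trans (cong φ x≡v) (sym φu≡φv)) ]′ x∈
      uy : adj H u y ≡ true
      uy = in-H (twin-adj φx≡φu (fy∉ (inj₁ refl)) fx-fy)
      vy : adj H v y ≡ true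
      vy = in-H (twin-adj (trans φx≡φu φu≡φv) (fy∉ (inj₂ refl)) fx-fy)

  -- A side of K_{s,s} meets each block in at most t vertices, so h t ≤ s lets every vertex of H
  -- pick a vertex on the side of its colour class, all in distinct blocks.
  Kss-free : (H : Graph h) → Bipartite H → NoIsolated H → ¬ ContainsSub H F →
    ∀ {s} → h * t ≤ s → ¬ ContainsSub (K s) graph
  Kss-free {h} H (col , proper) no-isolated F-free {s} ht≤s (f , f-inj , f-adj) =
    F-free (ContainsSub-fromBlocks H no-isolated g (proj₂ chosen) g-adj)
    where
    e : Fin h → Fin s → ℕ
    e u y = toℕ (f (K-vertex s (col u) y))
    chosen : ∃ λ (y : Fin h → Fin s) → Injective _≡_ _≡_ (λ u → e u (y u) / t)
    chosen = separate-blocks h t e (λ u → K-vertex-injective s (col u) ∘ f-inj ∘ toℕ-injective) ht≤s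
    g : Fin h → Fin n
    g u = f (K-vertex s (col u) (proj₁ chosen u))
    g-adj : ∀ u v → adj H u v ≡ true → adj graph (g u) (g v) ≡ true
    g-adj u v uv = f-adj _ _ (K-adj-sides s (proper u v uv) _ _)

  E : ℕ → ℕ → ℕ
  E i j = 𝟙 ((i <ᵇ j) ∧ linked i j)

  block-+ : ∀ u {a} → a < t → block (u * t + a) ≡ u
  block-+ u {a} a<t = begin
    (u * t + a) / t    ≡⟨ /-congˡ (+-comm (u * t) a) ⟩
    (a + u * t) / t    ≡⟨ +-distrib-/-∣ʳ a (divides u refl) ⟩
    a / t + u * t / t  ≡⟨ cong₂ _+_ (m<n⇒m/n≡0 a<t) (m*n/n≡m u t) ⟩
    u                  ∎
    where open ≡-Reasoning

  between-blocks : ∀ {u v a b} → a < t → b < t → 𝟙 ((u <ᵇ v) ∧ adjℕ F u v) ≤ E (u * t + a) (v * t + b)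
  between-blocks {u} {v} {a} {b} a<t b<t = 𝟙-mono λ uv → let u<v , F-uv = ∧≡true uv in
    let i<j = uta<vtb (<ᵇ≡true⇒< u<v) in
    cong₂ _∧_ (<⇒<ᵇ≡true i<j) (begin
      linked (u * t + a) (v * t + b)                  ≡⟨ linked≡near (<⇒≢ i<j) ⟩
      near (block (u * t + a)) (block (v * t + b))    ≡⟨ cong₂ near (block-+ u a<t) (block-+ v b<t) ⟩
      (u ≡ᵇ v) ∨ adjℕ F u v                           ≡⟨ cong ((u ≡ᵇ v) ∨_) F-uv ⟩
      (u ≡ᵇ v) ∨ true                                 ≡⟨ ∨-zeroʳ _ ⟩
      true                                            ∎)
    where
    open ≡-Reasoning
    uta<vtb : u < v → u * t + a < v * t + b
    uta<vtb u<v = ≤-trans (+-monoʳ-< (u * t) a<t) (≤-trans (≤-reflexive (+-comm (u * t) t))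
      (≤-trans (*-monoˡ-≤ t u<v) (m≤m+n (v * t) b)))

  within-block : ∀ {u a b} → a < t → b < t → 𝟙 (a <ᵇ b) ≤ E (u * t + a) (u * t + b)
  within-block {u} {a} {b} a<t b<t = 𝟙-mono λ a<ᵇb →
    let i<j = +-monoʳ-< (u * t) (<ᵇ≡true⇒< a<ᵇb) in
    cong₂ _∧_ (<⇒<ᵇ≡true i<j) (same-blockℕ (<⇒≢ i<j))
    where
    same-blockℕ : u * t + a ≢ u * t + b → linked (u * t + a) (u * t + b) ≡ true
    same-blockℕ i≢j = trans (linked≡near i≢j)
      (trans (cong₂ near (block-+ u a<t) (block-+ u b<t)) (near-refl u))

  block-pairs-≤-edges : m * t ≤ n →
    ∑[ u < m ] ∑[ a < t ] ∑[ v < m ] ∑[ b < t ] E (u * t + a) (v * t + b) ≤ edges graph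
  block-pairs-≤-edges mt≤n = begin
    ∑[ u < m ] ∑[ a < t ] ∑[ v < m ] ∑[ b < t ] E (u * t + a) (v * t + b)
      ≡⟨ ∑-blocks m t _ ⟨
    ∑[ i < m * t ] ∑[ v < m ] ∑[ b < t ] E i (v * t + b)
      ≡⟨ ∑-cong (m * t) (λ i _ → ∑-blocks m t (E i)) ⟨
    ∑[ i < m * t ] ∑[ j < m * t ] E i j
      ≤⟨ ∑-mono-≤ (m * t) (λ i _ → ∑-prefix-≤ (E i) mt≤n) ⟩
    ∑[ i < m * t ] ∑[ j < n ] E i j
      ≤⟨ ∑-prefix-≤ _ mt≤n ⟩
    ∑[ i < n ] ∑[ j < n ] E i j
      ≡⟨ edges≡∑ graph linked (λ _ _ → refl) ⟨
    edges graph
      ∎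
    where open ≤-Reasoning

  blown-up-edges-≤ : m * t ≤ n → t * t * edges F ≤ edges graph
  blown-up-edges-≤ mt≤n = begin
    t * t * edges F
      ≡⟨ cong (t * t *_) (edges≡∑ F (adjℕ F) (λ u v → sym (adjℕ-toℕ F u v))) ⟩
    t * t * (∑[ u < m ] ∑[ v < m ] P u v)
      ≡⟨ ∑-repeat m t P ⟨
    ∑[ u < m ] ∑[ a < t ] ∑[ v < m ] ∑[ b < t ] P u v
      ≤⟨ ∑-mono-≤ m (λ u _ → ∑-mono-≤ t (λ a a<t → ∑-mono-≤ m (λ v _ → ∑-mono-≤ t (λ b b<t →
           between-blocks a<t b<t)))) ⟩
    ∑[ u < m ] ∑[ a < t ] ∑[ v < m ] ∑[ b < t ] E (u * t + a) (v * t + b)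
      ≤⟨ block-pairs-≤-edges mt≤n ⟩
    edges graph
      ∎
    where
    open ≤-Reasoning
    P : ℕ → ℕ → ℕ
    P u v = 𝟙 ((u <ᵇ v) ∧ adjℕ F u v)

  clique-edges-≤ : m * t ≤ n → m * (∑[ a < t ] ∑[ b < t ] 𝟙 (a <ᵇ b)) ≤ edges graph
  clique-edges-≤ mt≤n = begin
    m * (∑[ a < t ] ∑[ b < t ] 𝟙 (a <ᵇ b))
      ≡⟨ ∑-const m _ ⟨
    ∑[ u < m ] ∑[ a < t ] ∑[ b < t ] 𝟙 (a <ᵇ b)
      ≤⟨ ∑-mono-≤ m (λ u _ → ∑-mono-≤ t (λ a a<t → ∑-mono-≤ t (λ b b<t → within-block {u} a<t b<t))) ⟩
    ∑[ u < m ] ∑[ a < t ] ∑[ b < t ] E (u * t + a) (u * t + b)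
      ≤⟨ ∑-mono-≤ m (λ u u<m → ∑-mono-≤ t (λ a _ →
           ∑-term-≤ m (λ v → ∑[ b < t ] E (u * t + a) (v * t + b)) u<m)) ⟩
    ∑[ u < m ] ∑[ a < t ] ∑[ v < m ] ∑[ b < t ] E (u * t + a) (v * t + b)
      ≤⟨ block-pairs-≤-edges mt≤n ⟩
    edges graph
      ∎
    where open ≤-Reasoning

<α⇒<1 : (α : Real01) → ∀ {r} → L α r → r <ℚ 1ℚ
<α⇒<1 α {r} r<α with lt1 α
... | q , q<1 , q≮α with q ℚ.≤? r
...   | yes q≤r = ⊥-elim (q≮α (down α q≤r r<α))
...   | no  q≰r = ℚ.<-trans (ℚ.≰⇒> q≰r) q<1

numerator≤denominator : ∀ {r} → 0ℚ <ℚ r → r <ℚ 1ℚ → ∣ ↥ r ∣ ≤ ↧ₙ r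
numerator≤denominator {mkℚ (ℤ.+ p) d _} _ r<1 = <⇒≤ (ℤ.drop‿+<+
  (subst₂ ℤ._<_ (ℤ.*-identityʳ (ℤ.+ p)) (ℤ.*-identityˡ (ℤ.+ suc d)) (ℚ.drop-*<* r<1)))
numerator≤denominator {mkℚ ℤ.-[1+ _ ] _ _} 0<r _ with ℚ.drop-*<* 0<r
... | ()

^-distribʳ-* : ∀ x y o → (x * y) ^ o ≡ x ^ o * y ^ o
^-distribʳ-* x y zero    = refl
^-distribʳ-* x y (suc o) = trans (cong (x * y *_) (^-distribʳ-* x y o)) (rearrange x y (x ^ o) (y ^ o))
  where
  rearrange : ∀ x y u v → x * y * (u * v) ≡ x * u * (y * v)
  rearrange = solve-∀

^-double : ∀ x q → x ^ (q + q) ≡ (x * x) ^ q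
^-double x q = trans (^-distribˡ-+-* x q q) (sym (^-distribʳ-* x x q))

scale-bound : ∀ {x s n μ M q p} → p ≤ q → s ≤ x → n ≤ x * μ → μ ^ (q + p) ≤ M ^ q →
  s ^ (q ∸ p) * n ^ (q + p) ≤ (x * x * M) ^ q
scale-bound {x} {s} {n} {μ} {M} {q} {p} p≤q s≤x n≤xμ μ-bound = begin
  s ^ (q ∸ p) * n ^ (q + p)                 ≤⟨ *-mono-≤ (^-monoˡ-≤ (q ∸ p) s≤x) (^-monoˡ-≤ (q + p) n≤xμ) ⟩
  x ^ (q ∸ p) * (x * μ) ^ (q + p)           ≡⟨ cong (x ^ (q ∸ p) *_) (^-distribʳ-* x μ (q + p)) ⟩
  x ^ (q ∸ p) * (x ^ (q + p) * μ ^ (q + p)) ≡⟨ *-assoc (x ^ (q ∸ p)) _ _ ⟨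
  x ^ (q ∸ p) * x ^ (q + p) * μ ^ (q + p)   ≡⟨ cong (_* μ ^ (q + p)) (^-distribˡ-+-* x (q ∸ p) (q + p)) ⟨
  x ^ (q ∸ p + (q + p)) * μ ^ (q + p)       ≡⟨ cong (λ e → x ^ e * μ ^ (q + p)) exponent ⟩
  x ^ (q + q) * μ ^ (q + p)                 ≤⟨ *-monoʳ-≤ (x ^ (q + q)) μ-bound ⟩
  x ^ (q + q) * M ^ q                       ≡⟨ cong (_* M ^ q) (^-double x q) ⟩
  (x * x) ^ q * M ^ q                       ≡⟨ ^-distribʳ-* (x * x) M q ⟨
  (x * x * M) ^ q                           ∎
  where
  open ≤-Reasoning
  exponent : q ∸ p + (q + p) ≡ q + q
  exponent = begin-equality
    q ∸ p + (q + p) ≡⟨ cong (_+_ (q ∸ p)) (+-comm q p) ⟩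
    q ∸ p + (p + q) ≡⟨ +-assoc (q ∸ p) p q ⟨
    q ∸ p + p + q   ≡⟨ cong (_+ q) (m∸n+n≡m p≤q) ⟩
    q + q           ∎

^-bound-fromGeqPow : ∀ {a} b x μ r → 0 < a → GeqPow a b x μ r → μ ^ (↧ₙ r + ∣ ↥ r ∣) ≤ (b * x) ^ ↧ₙ r
^-bound-fromGeqPow {suc a} _ _ _ r _ big = ≤-trans (m≤n*m _ (suc a ^ ↧ₙ r) {{>-nonZero (m^n>0 (suc a) (↧ₙ r))}}) big

^-bound-fromBound : ∀ {μ N q p} → μ ≤ N → 0 < N → p ≤ q → μ ^ (q + p) ≤ (μ * N) ^ q
^-bound-fromBound {μ} {N@(suc _)} {q} {p} μ≤N _ p≤q = begin
  μ ^ (q + p)     ≡⟨ ^-distribˡ-+-* μ q p ⟩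
  μ ^ q * μ ^ p   ≤⟨ *-monoʳ-≤ (μ ^ q) (≤-trans (^-monoˡ-≤ p μ≤N) (^-monoʳ-≤ N p≤q)) ⟩
  μ ^ q * N ^ q   ≡⟨ ^-distribʳ-* μ N q ⟨
  (μ * N) ^ q     ∎
  where open ≤-Reasoning

m≤[m/n]*n+[m/n]*n : ∀ m n .{{_ : NonZero n}} → 0 < m / n → m ≤ m / n * n + m / n * n
m≤[m/n]*n+[m/n]*n m n 0<m/n = begin
  m                         ≡⟨ m≡m%n+[m/n]*n m n ⟩
  m % n + m / n * n         ≤⟨ +-monoˡ-≤ (m / n * n) (<⇒≤ (m%n<n m n)) ⟩
  n + m / n * n             ≤⟨ +-monoˡ-≤ (m / n * n) (m≤n*m n (m / n) {{>-nonZero 0<m/n}}) ⟩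
  m / n * n + m / n * n     ∎
  where open ≤-Reasoning

¬ExOmega-order≤2 : ∀ {h} (H : Graph h) → h ≤ 2 → (α : Real01) → ¬ ExOmega H α
¬ExOmega-order≤2 H h≤2 α (suc a , b , _ , _ , N , ext) with ext (suc N) (n≤1+n N) | pos α
... | F , F-free , F-big | r , 0<r , r<α = <⇒≱ (*-mono-≤ (m^n>0 (suc a) q) (m^n>0 (suc N) (q + p))) bound
  where
  q p : ℕ
  q = ↧ₙ r
  p = ∣ ↥ r ∣
  no-edges : ∀ i j → adj F i j ≡ false
  no-edges i j with adj F i j in ij
  ... | false = refl
  ... | true  = ⊥-elim (F-free (edge⇒ContainsSub-order≤2 H F h≤2 ij))
  bound : suc a ^ q * suc N ^ (q + p) ≤ 0
  bound = subst (λ e → suc a ^ q * suc N ^ (q + p) ≤ e ^ q)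
    (trans (cong (b *_) (edgeless⇒edges≡0 F no-edges)) (*-zeroʳ b)) (F-big r 0<r r<α)

module Construction {h} (H : Graph h) (conn : Connected H) (bip : Bipartite H) (3≤h : 3 ≤ h)
  (α : Real01) {a b N : ℕ} (0<a : 0 < a) (0<b : 0 < b) (ext : ∀ n → N ≤ n → ExAtLeast H a b n α) where

  0<h : 0 < h
  0<h = ≤-trans (s≤s z≤n) 3≤h

  no-isolated : NoIsolated H
  no-isolated = connected⇒NoIsolated H (≤-trans (n≤1+n 2) 3≤h) conn

  exponents : ∀ r → 0ℚ <ℚ r → L α r → ∣ ↥ r ∣ ≤ ↧ₙ r
  exponents r 0<r r<α = numerator≤denominator 0<r (<α⇒<1 α r<α)

  -- c dominates s / κ and n / (κ μ) in every case: s ≤ 4 h k and n ≤ 4 k m when t = 2 k, s < 2 h,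
  -- and s ≤ n ≤ N.
  c D B : ℕ
  c = 4 * h + N
  D = b * suc N
  B = c * c * D

  instance
    h+h≢0 : NonZero (h + h)
    h+h≢0 = >-nonZero (≤-trans 0<h (m≤m+n h h))

  4h≤c : 4 * h ≤ c
  4h≤c = m≤m+n (4 * h) N

  4≤c : 4 ≤ c
  4≤c = ≤-trans (*-monoʳ-≤ 4 0<h) 4h≤c

  N≤c : N ≤ c
  N≤c = m≤n+m N (4 * h)

  0<B : 0 < B
  0<B = *-mono-≤ {1} {c * c} {1} {D} (*-mono-≤ {1} {c} {1} {c} 0<c 0<c)
    (*-mono-≤ {1} {b} {1} {suc N} 0<b (s≤s z≤n))
    where 0<c = ≤-trans (s≤s z≤n) 4≤c

  GeqExp2-fromScale : ∀ {s n κ μ M Y y} → s ≤ c * κ → n ≤ c * κ * μ →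
    (∀ r → 0ℚ <ℚ r → L α r → μ ^ (↧ₙ r + ∣ ↥ r ∣) ≤ M ^ ↧ₙ r) → M ≤ D * Y → κ * κ * Y ≤ y →
    GeqExp2 1 B y s n α
  GeqExp2-fromScale {s} {n} {κ} {μ} {M} {Y} {y} s≤cκ n≤cκμ μ-bound M≤DY κκY≤y r 0<r r<α = begin
    1 ^ q * s ^ (q ∸ p) * n ^ (q + p)   ≡⟨ cong (λ z → z * s ^ (q ∸ p) * n ^ (q + p)) (^-zeroˡ q) ⟩
    1 * s ^ (q ∸ p) * n ^ (q + p)       ≡⟨ cong (_* n ^ (q + p)) (*-identityˡ (s ^ (q ∸ p))) ⟩
    s ^ (q ∸ p) * n ^ (q + p)           ≤⟨ scale-bound (exponents r 0<r r<α) s≤cκ n≤cκμ (μ-bound r 0<r r<α) ⟩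
    (c * κ * (c * κ) * M) ^ q           ≤⟨ ^-monoˡ-≤ q constants ⟩
    (B * y) ^ q                         ∎
    where
    open ≤-Reasoning
    q p : ℕ
    q = ↧ₙ r
    p = ∣ ↥ r ∣
    rearrange : ∀ c κ D Y → c * κ * (c * κ) * (D * Y) ≡ c * c * D * (κ * κ * Y)
    rearrange = solve-∀
    constants : c * κ * (c * κ) * M ≤ B * y
    constants = begin
      c * κ * (c * κ) * M        ≤⟨ *-monoʳ-≤ (c * κ * (c * κ)) M≤DY ⟩
      c * κ * (c * κ) * (D * Y)  ≡⟨ rearrange c κ D Y ⟩
      c * c * D * (κ * κ * Y)    ≤⟨ *-monoʳ-≤ B κκY≤y ⟩
      B * y                      ∎

  ExStar-fromBlowUp : ∀ {m n s} (F : Graph m) t .{{_ : NonZero t}} → ¬ ContainsSub H F → h * t ≤ s →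
    GeqExp2 1 B (edges (BlowUp.graph F t n)) s n α → ExStarAtLeast H 1 B n s α
  ExStar-fromBlowUp F t F-free ht≤s big =
    graph , Kss-free H bip no-isolated F-free ht≤s , induced-free H conn bip 3≤h F-free , big
    where open BlowUp F t _

  m*N′≤D*m : ∀ m → m * suc N ≤ D * m
  m*N′≤D*m m = begin
    m * suc N      ≡⟨ *-comm m (suc N) ⟩
    suc N * m      ≤⟨ *-monoˡ-≤ m (m≤n*m (suc N) b {{>-nonZero 0<b}}) ⟩
    b * suc N * m  ∎
    where open ≤-Reasoning

  ExStar-fromExtremal : ∀ {m n s} t .{{_ : NonZero t}} κ → N ≤ m → h * t ≤ s → m * t ≤ n →
    s ≤ c * κ → n ≤ c * κ * m → κ ≤ t → ExStarAtLeast H 1 B n s α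
  ExStar-fromExtremal {m} {n} t κ N≤m ht≤s mt≤n s≤cκ n≤cκm κ≤t with ext m N≤m
  ... | F , F-free , F-big = ExStar-fromBlowUp F t F-free ht≤s
    (GeqExp2-fromScale s≤cκ n≤cκm (λ r 0<r r<α → ^-bound-fromGeqPow b (edges F) m r 0<a (F-big r 0<r r<α))
      be≤De κκe≤e)
    where
    be≤De : b * edges F ≤ D * edges F
    be≤De = *-monoˡ-≤ (edges F) (m≤m*n b (suc N))
    κκe≤e : κ * κ * edges F ≤ edges (BlowUp.graph F t n)
    κκe≤e = ≤-trans (*-monoˡ-≤ (edges F) (*-mono-≤ κ≤t κ≤t)) (BlowUp.blown-up-edges-≤ F t n mt≤n)

  ExStar-fromCliques : ∀ {m n s} k .{{_ : NonZero (k + k)}} → m ≤ suc N → h * (k + k) ≤ s →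
    m * (k + k) ≤ n → s ≤ c * k → n ≤ c * k * m → ExStarAtLeast H 1 B n s α
  ExStar-fromCliques {m} {n} k m≤N′ ht≤s mt≤n s≤ck n≤ckm =
    ExStar-fromBlowUp (edgeless m) (k + k) (edgeless-free H (proj₂ (no-isolated (fromℕ< 0<h)))) ht≤s
      (GeqExp2-fromScale s≤ck n≤ckm (λ r 0<r r<α → ^-bound-fromBound m≤N′ (s≤s z≤n) (exponents r 0<r r<α))
        (m*N′≤D*m m) kkm≤e)
    where
    kkm≤e : k * k * m ≤ edges (BlowUp.graph (edgeless m) (k + k) n)
    kkm≤e = begin
      k * k * m                                        ≡⟨ *-comm (k * k) m ⟩
      m * (k * k)                                      ≤⟨ *-monoʳ-≤ m (k*k≤pairs k) ⟩
      m * (∑[ a < k + k ] ∑[ b < k + k ] 𝟙 (a <ᵇ b))   ≤⟨ BlowUp.clique-edges-≤ (edgeless m) (k + k) n mt≤n ⟩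
      edges (BlowUp.graph (edgeless m) (k + k) n)      ∎
      where open ≤-Reasoning

  ExStar-small-n : ∀ {n s} → h ≤ s → s ≤ n → n ≤ N → ExStarAtLeast H 1 B n s α
  ExStar-small-n {n} {s} h≤s s≤n n≤N =
    ExStar-fromBlowUp (K 1) 1 K₁-free (≤-trans (≤-reflexive (*-identityʳ h)) h≤s)
      (GeqExp2-fromScale {κ = 1} {μ = 1} s≤c n≤c
        (λ r 0<r r<α → ^-bound-fromBound (s≤s z≤n) (s≤s z≤n) (exponents r 0<r r<α)) (m*N′≤D*m 1) one-edge)
    where
    K₁-free : ¬ ContainsSub H (K 1)
    K₁-free K₁⊇H = <⇒≱ 3≤h (ContainsSub⇒≤ H (K 1) K₁⊇H)
    s≤c : s ≤ c * 1
    s≤c = subst (s ≤_) (sym (*-identityʳ c)) (≤-trans s≤n (≤-trans n≤N N≤c))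
    n≤c : n ≤ c * 1 * 1
    n≤c = subst (n ≤_) (sym (trans (*-identityʳ (c * 1)) (*-identityʳ c))) (≤-trans n≤N N≤c)
    -- edges (K 1) evaluates to 1, so blown-up-edges-≤ states exactly this.
    one-edge : 1 * 1 * 1 ≤ edges (BlowUp.graph (K 1) 1 n)
    one-edge = BlowUp.blown-up-edges-≤ (K 1) 1 n (≤-trans (≤-trans (n≤1+n 2) 3≤h) (≤-trans h≤s s≤n))

  ExStar-small-s : ∀ {n s} → h ≤ s → s < h + h → N ≤ n → ExStarAtLeast H 1 B n s α
  ExStar-small-s {n} {s} h≤s s<2h N≤n = ExStar-fromExtremal 1 1 N≤n
    (≤-trans (≤-reflexive (*-identityʳ h)) h≤s) (≤-reflexive (*-identityʳ n)) s≤c n≤cn ≤-refl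
    where
    double : ∀ h → h + h + (h + h) ≡ 4 * h
    double = solve-∀
    s≤c : s ≤ c * 1
    s≤c = subst (s ≤_) (sym (*-identityʳ c))
      (≤-trans (<⇒≤ s<2h) (≤-trans (subst (h + h ≤_) (double h) (m≤m+n (h + h) (h + h))) 4h≤c))
    n≤cn : n ≤ c * 1 * n
    n≤cn = subst (_≤ c * 1 * n) (*-identityˡ n)
      (*-monoˡ-≤ n (≤-trans (≤-trans (s≤s z≤n) 4≤c) (≤-reflexive (sym (*-identityʳ c)))))

  module LargeS {n s} (h≤s : h ≤ s) (s≤n : s ≤ n) (k′ : ℕ) (k≡ : s / (h + h) ≡ suc k′) where

    k t m : ℕ
    k = suc k′
    t = k + k
    m = n / t

    ht≤s : h * t ≤ s
    ht≤s = begin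
      h * (k + k)            ≡⟨ swap h k ⟩
      k * (h + h)            ≡⟨ cong (_* (h + h)) k≡ ⟨
      s / (h + h) * (h + h)  ≤⟨ m/n*n≤m s (h + h) ⟩
      s                      ∎
      where
      open ≤-Reasoning
      swap : ∀ h k → h * (k + k) ≡ k * (h + h)
      swap = solve-∀

    mt≤n : m * t ≤ n
    mt≤n = m/n*n≤m n t

    s≤ck : s ≤ c * k
    s≤ck = begin
      s                                              ≤⟨ m≤[m/n]*n+[m/n]*n s (h + h) (subst (0 <_) (sym k≡) (s≤s z≤n)) ⟩
      s / (h + h) * (h + h) + s / (h + h) * (h + h)  ≡⟨ cong (λ q → q * (h + h) + q * (h + h)) k≡ ⟩
      k * (h + h) + k * (h + h)                      ≡⟨ four h k ⟩
      4 * h * k                                      ≤⟨ *-monoˡ-≤ k 4h≤c ⟩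
      c * k                                          ∎
      where
      open ≤-Reasoning
      four : ∀ h k → k * (h + h) + k * (h + h) ≡ 4 * h * k
      four = solve-∀

    n≤ckm : n ≤ c * k * m
    n≤ckm = begin
      n                  ≤⟨ m≤[m/n]*n+[m/n]*n n t (m≥n⇒m/n>0 t≤n) ⟩
      m * t + m * t      ≡⟨ four k m ⟩
      4 * k * m          ≤⟨ *-monoˡ-≤ m (*-monoˡ-≤ k 4≤c) ⟩
      c * k * m          ∎
      where
      open ≤-Reasoning
      four : ∀ k m → m * (k + k) + m * (k + k) ≡ 4 * k * m
      four = solve-∀
      t≤n : t ≤ n
      t≤n = ≤-trans (m≤n*m t h {{>-nonZero 0<h}}) (≤-trans ht≤s s≤n)

    ExStar-large-s : ExStarAtLeast H 1 B n s α
    ExStar-large-s with N ≤? m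
    ... | yes N≤m = ExStar-fromExtremal t k N≤m ht≤s mt≤n s≤ck n≤ckm (m≤m+n k k)
    ... | no  N≰m = ExStar-fromCliques k (<⇒≤ (≤-trans (≰⇒> N≰m) (n≤1+n N))) ht≤s mt≤n s≤ck n≤ckm

  ExStar-bound : ∀ n s → h ≤ s → s ≤ n → ExStarAtLeast H 1 B n s α
  ExStar-bound n s h≤s s≤n with N ≤? n | s / (h + h) in k≡
  ... | no  N≰n | _      = ExStar-small-n h≤s s≤n (<⇒≤ (≰⇒> N≰n))
  ... | yes N≤n | zero   = ExStar-small-s h≤s (m/n≡0⇒m<n k≡) N≤n
  ... | yes _   | suc k′ = LargeS.ExStar-large-s h≤s s≤n k′ k≡

proposition1p4 : ∀ {h : ℕ} (H : Graph h) → Connected H → Bipartite H →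
    (α : Real01) → ExOmega H α →
    Σ ℕ λ a → Σ ℕ λ b → 0 < a × 0 < b ×
      (∀ (n s : ℕ) → h ≤ s → s ≤ n → ExStarAtLeast H a b n s α)
proposition1p4 {h} H conn bip α ex@(a , b , 0<a , 0<b , N , ext) with 3 ≤? h
... | no  3≰h = ⊥-elim (¬ExOmega-order≤2 H (≤-pred (≰⇒> 3≰h)) α ex)
... | yes 3≤h = 1 , B , s≤s z≤n , 0<B , ExStar-bound
  where open Construction H conn bip 3≤h α 0<a 0<b ext
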